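{- Let $\mathcal C=(c_{ij})_{i,j\ge0}$ be an infinite tridiagonal matrix (rows and columns indexed by nonnegative integers, $c_{ij}=0$ if $|i-j|>1$), whose nonzero entries are indeterminates (or complex numbers for which the denominators below are nonzero). Let $\mathcal Z_k=(\mathcal C^k)_{0,0}$ for $k\ge0$, let $\mathcal C\mathrm{Motz}(N,r)$ be the generating function of $\mathcal C$-weighted partial Motzkin paths from $(0,0)$ to $(N,r)$, and let $k_r=\prod_{i=0}^{r-1}c_{i,i+1}$. Then for integers $N\ge r\ge0$, $$\frac{1}{k_r}\,\mathcal C\mathrm{Motz}(N,r)=\frac{1}{k_r}(\mathcal C^N)_{0,r}=\mathcal K_{(N-r,0,\dots,0)},$$ where $(N-r,0,\dots,0)$ has exactly $r$ zeros (so $n=r+1$ entries).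
   Context: A partial Motzkin path from $(0,0)$ to $(N,r)$ is a lattice path using steps $(1,1)$, $(1,0)$, $(1,-1)$ that never goes below the $x$-axis; a step from height $i$ to height $j$ gets weight $c_{ij}$, a path gets the product of its step weights, and the generating function is the sum of weights of all such paths. For an integer sequence $\mu=(\mu_1,\dots,\mu_n)$ with $\mu_i+n-i\ge0$ for all $i$, define $$\mathcal K_{\mu}=\frac{\det\big(\mathcal Z_{\mu_i+2n-i-j}\big)_{i,j=1}^n}{\det\big(\mathcal Z_{2n-i-j}\big)_{i,j=1}^n}.$$ -}

module Defs where

open import Level using (Level)
open import Algebra.Bundles using (CommutativeRing)
open import Data.Nat as ℕ using (ℕ; zero; suc; _∸_)
open import Data.Fin using (Fin; punchIn; toℕ) renaming (zero to fzero; suc to fsuc)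
open import Data.Sum using (_⊎_)
open import Relation.Nullary using (yes; no)
import Data.List as L
open import Data.List using (List; []; _∷_; concatMap)
open import Data.Maybe using (Maybe; just; nothing)

module Tridiag {c ℓ : Level} (R : CommutativeRing c ℓ) where
  open CommutativeRing R

  Matrix : Set c
  Matrix = ℕ → ℕ → Carrier

  IsTridiagonal : Matrix → Set ℓ
  IsTridiagonal C = ∀ i j → (suc i ℕ.< j ⊎ suc j ℕ.< i) → C i j ≈ 0#

  sumℕ : ℕ → (ℕ → Carrier) → Carrier
  sumℕ zero    f = 0#
  sumℕ (suc n) f = sumℕ n f + f n

  sumFin : (n : ℕ) → (Fin n → Carrier) → Carrier
  sumFin zero    f = 0#
  sumFin (suc n) f = f fzero + sumFin n (λ j → f (fsuc j))

  -- For a tridiagonal C the row i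
  -- of C^k vanishes beyond column i+k, so the sum over m ≤ i+k is the full
  -- (well-defined) infinite matrix product.
  δ : ℕ → ℕ → Carrier
  δ zero    zero    = 1#
  δ zero    (suc j) = 0#
  δ (suc i) zero    = 0#
  δ (suc i) (suc j) = δ i j

  pow : Matrix → ℕ → Matrix
  pow C zero    i j = δ i j
  pow C (suc k) i j = sumℕ (suc (i ℕ.+ k)) (λ m → pow C k i m * C m j)

  Z : Matrix → ℕ → Carrier
  Z C k = pow C k 0 0

  kr : Matrix → ℕ → Carrier
  kr C zero    = 1#
  kr C (suc r) = kr C r * C r (suc r)

  data Step : Set where
    up flat down : Step

  allSteps : ℕ → List (List Step)
  allSteps zero    = [] ∷ []
  allSteps (suc n) = concatMap (λ s → (up ∷ s) ∷ (flat ∷ s) ∷ (down ∷ s) ∷ []) (allSteps n)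

  next : ℕ → Step → Maybe ℕ
  next h       up   = just (suc h)
  next h       flat = just h
  next zero    down = nothing
  next (suc h) down = just h

  endFrom : ℕ → List Step → Maybe ℕ
  endFrom h []       = just h
  endFrom h (s ∷ ss) with next h s
  ... | nothing = nothing
  ... | just h' = endFrom h' ss

  weightFrom : Matrix → ℕ → List Step → Carrier
  weightFrom C h []       = 1#
  weightFrom C h (s ∷ ss) with next h s
  ... | nothing = 0#
  ... | just h' = C h h' * weightFrom C h' ss

  endsAt : Maybe ℕ → ℕ → Carrier → Carrier
  endsAt nothing  r w = 0#
  endsAt (just h) r w with h ℕ.≟ r
  ... | yes _ = w
  ... | no  _ = 0#

  sumList : List Carrier → Carrier
  sumList []       = 0#
  sumList (x ∷ xs) = x + sumList xs

  CMotz : Matrix → ℕ → ℕ → Carrier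
  CMotz C N r = sumList (L.map (λ s → endsAt (endFrom 0 s) r (weightFrom C 0 s)) (allSteps N))

  sign : ℕ → Carrier → Carrier
  sign zero    x = x
  sign (suc k) x = - sign k x

  det : (n : ℕ) → (Fin n → Fin n → Carrier) → Carrier
  det zero    M = 1#
  det (suc n) M = sumFin (suc n) (λ j →
    sign (toℕ j) (M fzero j * det n (λ a b → M (fsuc a) (punchIn j b))))

  -- Numerator determinant det(𝒵_{μ_i + 2n - i - j})_{i,j=1..n}, written with
  -- 0-based indices i', j' (i = i'+1, j = j'+1): exponent μ_{i'} + (2n-2) - i' - j'.
  -- Here μ has natural-number entries (sufficient for μ = (N-r,0,…,0)).
  numDet : Matrix → (n : ℕ) → (Fin n → ℕ) → Carrier
  numDet C n μ = det n (λ i j → Z C (μ i ℕ.+ ((2 ℕ.* n ∸ 2) ∸ toℕ i ∸ toℕ j)))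

  hook : (n : ℕ) → ℕ → Fin n → ℕ
  hook n m fzero    = m
  hook n m (fsuc _) = 0

module Submission where

-- The path sum and (C^N)_{0,r} satisfy the same recursion in N: a path from height h starts with a step
-- to h+1, h or h-1, and for tridiagonal C these are the only nonzero terms of (C · C^N)_{h,r}.
--
-- For the determinants (indices 0..r) split the exponent μ_i + 2r - i - j as (μ_i + r - i) + (r - j), so
-- that Z_{μ_i+2r-i-j} = Σ_m (C^{μ_i+r-i})_{0,r-m} (C^{r-j})_{r-m,0}. Row h of C^k is supported in
-- columns h-k..h+k, hence for μ = (m,0,…,0) the first factor is upper and the second lower triangular,
-- and the determinant is (C^{m+r})_{0,r} times a product of diagonal entries that does not depend on m.
-- For m = 0 that first entry is (C^r)_{0,r} = k_r, and the ratio of the two determinants is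
-- (C^N)_{0,r} / k_r. The rule det(AB) = ∏ A_ii · det B for upper triangular A needs the Laplace
-- expansion to be multilinear and alternating; on the first two rows this reduces, by expanding both
-- rows in the standard basis, to the antisymmetry of the determinants with two basis rows.

open import Defs
open import Level using (Level)
open import Algebra.Bundles using (CommutativeRing)
open import Data.Nat using (ℕ; suc; _≤_; _∸_)
open import Data.Product using (_×_)

open import Data.Nat as ℕ using (zero; z≤n; s≤s)
import Data.Nat.Properties as ℕ
open import Data.Fin as Fin using (Fin; punchIn; punchOut; toℕ) renaming (zero to fzero; suc to fsuc)
open import Data.Fin.Properties using (punchIn-punchOut; toℕ≤pred[n])
open import Data.Product using (_,_)
open import Data.Sum as Sum using (_⊎_; inj₁; inj₂)
open import Data.Empty using (⊥-elim)
open import Function using (_∘_)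
open import Relation.Nullary using (¬_; yes; no)
open import Relation.Binary.PropositionalEquality as ≡ using (_≡_)

-- the position of column j among the columns other than punchIn j k′
partner : ∀ {n} → Fin (suc (suc n)) → Fin (suc n) → Fin (suc n)
partner         fzero    k′        = fzero
partner         (fsuc j) fzero     = j
partner {suc n} (fsuc j) (fsuc k′) = fsuc (partner j k′)

punchIn-partner : ∀ {n} (j : Fin (suc (suc n))) k′ → punchIn (punchIn j k′) (partner j k′) ≡ j
punchIn-partner         fzero    k′        = ≡.refl
punchIn-partner         (fsuc j) fzero     = ≡.refl
punchIn-partner {suc n} (fsuc j) (fsuc k′) = ≡.cong fsuc (punchIn-partner j k′)

punchIn-punchIn-partner : ∀ {n} (j : Fin (suc (suc n))) k′ b →
  punchIn j (punchIn k′ b) ≡ punchIn (punchIn j k′) (punchIn (partner j k′) b)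
punchIn-punchIn-partner         fzero    k′        b        = ≡.refl
punchIn-punchIn-partner         (fsuc j) fzero     b        = ≡.refl
punchIn-punchIn-partner {suc n} (fsuc j) (fsuc k′) fzero    = ≡.refl
punchIn-punchIn-partner {suc n} (fsuc j) (fsuc k′) (fsuc b) = ≡.cong fsuc (punchIn-punchIn-partner j k′ b)

partner-parity : ∀ {n} (j : Fin (suc (suc n))) k′ →
  toℕ j ℕ.+ toℕ k′ ≡ suc (toℕ (punchIn j k′) ℕ.+ toℕ (partner j k′)) ⊎
  suc (toℕ j ℕ.+ toℕ k′) ≡ toℕ (punchIn j k′) ℕ.+ toℕ (partner j k′)
partner-parity         fzero    k′        = inj₂ (≡.cong suc (≡.sym (ℕ.+-identityʳ (toℕ k′))))
partner-parity         (fsuc j) fzero     = inj₁ (≡.cong suc (ℕ.+-identityʳ (toℕ j)))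
partner-parity {suc n} (fsuc j) (fsuc k′) = Sum.map
  (λ eq → ≡.trans (+-suc-suc _ _) (≡.trans (≡.cong (λ t → suc (suc t)) eq) (≡.cong suc (≡.sym (+-suc-suc _ _)))))
  (λ eq → ≡.trans (≡.cong suc (+-suc-suc _ _)) (≡.trans (≡.cong (λ t → suc (suc t)) eq) (≡.sym (+-suc-suc _ _))))
  (partner-parity j k′)
  where
  +-suc-suc : ∀ a b → suc a ℕ.+ suc b ≡ suc (suc (a ℕ.+ b))
  +-suc-suc a b = ≡.cong suc (ℕ.+-suc a b)

module Determinant {c ℓ : Level} (R : CommutativeRing c ℓ) where
  open CommutativeRing R
  open Tridiag R using (sumFin; sign; det)
  open import Algebra.Properties.Semiring.Sum semiring
  open import Algebra.Properties.Monoid.Sum *-monoid public using () renaming (sum to product)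
  open import Algebra.Properties.Ring ring using (-‿distribˡ-*; -‿distribʳ-*; -‿involutive; -0#≈0#; +-inverseˡ-unique; -‿+-comm)
  open import Algebra.Properties.CommutativeSemigroup *-commutativeSemigroup using (x∙yz≈y∙xz)
  open import Data.Vec.Functional using (_∷_)
  open import Relation.Binary.Reasoning.Setoid setoid

  Square : ℕ → Set c
  Square n = Fin n → Fin n → Carrier

  sumFin≡sum : ∀ n (f : Fin n → Carrier) → sumFin n f ≡ sum f
  sumFin≡sum zero    f = ≡.refl
  sumFin≡sum (suc n) f = ≡.cong (f fzero +_) (sumFin≡sum n (λ i → f (fsuc i)))

  sum-≈0 : ∀ {n} (f : Fin n → Carrier) → (∀ i → f i ≈ 0#) → sum f ≈ 0#
  sum-≈0 {n} f f≈0 = trans (sum-cong-≋ f≈0) (sum-replicate-zero n)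

  sign-cong : ∀ k {x y} → x ≈ y → sign k x ≈ sign k y
  sign-cong zero    x≈y = x≈y
  sign-cong (suc k) x≈y = -‿cong (sign-cong k x≈y)

  sign≈* : ∀ k x → sign k x ≈ sign k 1# * x
  sign≈* zero    x = sym (*-identityˡ x)
  sign≈* (suc k) x = trans (-‿cong (sign≈* k x)) (-‿distribˡ-* _ x)

  sign-0# : ∀ k → sign k 0# ≈ 0#
  sign-0# k = trans (sign≈* k 0#) (zeroʳ _)

  sign-*ˡ : ∀ k a x → sign k (a * x) ≈ a * sign k x
  sign-*ˡ k a x = begin
    sign k (a * x)       ≈⟨ sign≈* k _ ⟩
    sign k 1# * (a * x)  ≈⟨ x∙yz≈y∙xz _ a x ⟩
    a * (sign k 1# * x)  ≈⟨ *-congˡ (sign≈* k x) ⟨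
    a * sign k x         ∎

  sign-sum : ∀ k {n} (f : Fin n → Carrier) → sign k (sum f) ≈ sum (λ i → sign k (f i))
  sign-sum k f = begin
    sign k (sum f)                   ≈⟨ sign≈* k _ ⟩
    sign k 1# * sum f                ≈⟨ *-distribˡ-sum _ f ⟩
    sum (λ i → sign k 1# * f i)      ≈⟨ sum-cong-≋ (λ i → sign≈* k (f i)) ⟨
    sum (λ i → sign k (f i))         ∎

  sign-+ : ∀ a b x → sign a (sign b x) ≡ sign (a ℕ.+ b) x
  sign-+ zero    b x = ≡.refl
  sign-+ (suc a) b x = ≡.cong -_ (sign-+ a b x)

  sign-adjacent : ∀ {a b} x → a ≡ suc b ⊎ suc a ≡ b → sign a x ≈ - sign b x
  sign-adjacent x (inj₁ ≡.refl) = refl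
  sign-adjacent x (inj₂ ≡.refl) = sym (-‿involutive _)

  laplace : ∀ {n} → (Fin (suc n) → Carrier) → (Fin (suc n) → Carrier) → Carrier
  laplace {n} v D = ∑[ j < suc n ] sign (toℕ j) (v j * D j)

  minors : ∀ {n} → (Fin n → Fin (suc n) → Carrier) → Fin (suc n) → Carrier
  minors {n} S j = det n (λ a b → S a (punchIn j b))

  det-laplace : ∀ n (M : Square (suc n)) → det (suc n) M ≡ laplace (M fzero) (minors (λ a → M (fsuc a)))
  det-laplace n M = sumFin≡sum (suc n) (λ j → sign (toℕ j) (M fzero j * minors (λ a → M (fsuc a)) j))

  laplace-cong : ∀ {n} {v D v′ D′ : Fin (suc n) → Carrier} →
    (∀ j → v j * D j ≈ v′ j * D′ j) → laplace v D ≈ laplace v′ D′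
  laplace-cong eq = sum-cong-≋ (λ j → sign-cong (toℕ j) (eq j))

  laplace-≈0 : ∀ {n} {v D : Fin (suc n) → Carrier} → (∀ j → v j * D j ≈ 0#) → laplace v D ≈ 0#
  laplace-≈0 eq = sum-≈0 _ (λ j → trans (sign-cong (toℕ j) (eq j)) (sign-0# (toℕ j)))

  laplace-comm : ∀ {n} (v D : Fin (suc n) → Carrier) → laplace v D ≈ laplace D v
  laplace-comm v D = laplace-cong (λ j → *-comm (v j) (D j))

  ∑-sign-*ˡ : ∀ {n} a (f : Fin n → Carrier) → ∑[ j < n ] sign (toℕ j) (a * f j) ≈ a * ∑[ j < n ] sign (toℕ j) (f j)
  ∑-sign-*ˡ a f = trans (sum-cong-≋ (λ j → sign-*ˡ (toℕ j) a (f j))) (sym (*-distribˡ-sum a (λ j → sign (toℕ j) (f j))))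

  laplace-*ʳ : ∀ {n} a (v D : Fin (suc n) → Carrier) → laplace v (λ j → a * D j) ≈ a * laplace v D
  laplace-*ʳ a v D = trans (laplace-cong (λ j → x∙yz≈y∙xz (v j) a (D j))) (∑-sign-*ˡ a (λ j → v j * D j))

  laplace-linearˡ : ∀ {n m} (y : Fin m → Carrier) (w : Fin m → Fin (suc n) → Carrier) (D : Fin (suc n) → Carrier) →
    laplace (λ j → ∑[ k < m ] (y k * w k j)) D ≈ ∑[ k < m ] (y k * laplace (w k) D)
  laplace-linearˡ {n} {m} y w D = begin
    ∑[ j < suc n ] sign (toℕ j) ((∑[ k < m ] (y k * w k j)) * D j)
      ≈⟨ sum-cong-≋ (λ j → sign-cong (toℕ j) (trans (*-distribʳ-sum (D j) (λ k → y k * w k j))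
                                                      (sum-cong-≋ (λ k → *-assoc (y k) (w k j) (D j))))) ⟩
    ∑[ j < suc n ] sign (toℕ j) (∑[ k < m ] (y k * (w k j * D j)))
      ≈⟨ sum-cong-≋ (λ j → sign-sum (toℕ j) (λ k → y k * (w k j * D j))) ⟩
    ∑[ j < suc n ] ∑[ k < m ] sign (toℕ j) (y k * (w k j * D j))
      ≈⟨ ∑-comm (λ j k → sign (toℕ j) (y k * (w k j * D j))) ⟩
    ∑[ k < m ] ∑[ j < suc n ] sign (toℕ j) (y k * (w k j * D j))
      ≈⟨ sum-cong-≋ (λ k → ∑-sign-*ˡ (y k) (λ j → w k j * D j)) ⟩
    ∑[ k < m ] (y k * laplace (w k) D) ∎

  laplace-linearʳ : ∀ {n m} (y : Fin m → Carrier) (v : Fin (suc n) → Carrier) (D : Fin m → Fin (suc n) → Carrier) →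
    laplace v (λ j → ∑[ k < m ] (y k * D k j)) ≈ ∑[ k < m ] (y k * laplace v (D k))
  laplace-linearʳ y v D = begin
    laplace v (λ j → ∑[ k < _ ] (y k * D k j))  ≈⟨ laplace-comm v (λ j → ∑[ k < _ ] (y k * D k j)) ⟩
    laplace (λ j → ∑[ k < _ ] (y k * D k j)) v  ≈⟨ laplace-linearˡ y D v ⟩
    ∑[ k < _ ] (y k * laplace (D k) v)          ≈⟨ sum-cong-≋ (λ k → *-congˡ (laplace-comm (D k) v)) ⟩
    ∑[ k < _ ] (y k * laplace v (D k))          ∎

  basis : ∀ {n} → Fin n → Fin n → Carrier
  basis fzero    fzero    = 1#
  basis fzero    (fsuc _) = 0#
  basis (fsuc _) fzero    = 0#
  basis (fsuc i) (fsuc j) = basis i j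

  basis-punchIn : ∀ {n} (j : Fin (suc n)) a b → basis (punchIn j a) (punchIn j b) ≡ basis a b
  basis-punchIn fzero    a        b        = ≡.refl
  basis-punchIn (fsuc j) fzero    fzero    = ≡.refl
  basis-punchIn (fsuc j) fzero    (fsuc b) = ≡.refl
  basis-punchIn (fsuc j) (fsuc a) fzero    = ≡.refl
  basis-punchIn (fsuc j) (fsuc a) (fsuc b) = basis-punchIn j a b

  basis-punchIn-self : ∀ {n} (j : Fin (suc n)) b → basis j (punchIn j b) ≡ 0#
  basis-punchIn-self fzero    b        = ≡.refl
  basis-punchIn-self (fsuc j) fzero    = ≡.refl
  basis-punchIn-self (fsuc j) (fsuc b) = basis-punchIn-self j b

  ∑-basisˡ : ∀ {n} (j : Fin n) (f : Fin n → Carrier) → ∑[ c < n ] (basis j c * f c) ≈ f j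
  ∑-basisˡ {suc n} fzero    f = begin
    1# * f fzero + ∑[ c < n ] (0# * f (fsuc c))  ≈⟨ +-cong (*-identityˡ _) (sum-≈0 _ (λ c → zeroˡ (f (fsuc c)))) ⟩
    f fzero + 0#                                 ≈⟨ +-identityʳ _ ⟩
    f fzero                                      ∎
  ∑-basisˡ {suc n} (fsuc j) f = begin
    0# * f fzero + ∑[ c < n ] (basis j c * f (fsuc c))  ≈⟨ +-cong (zeroˡ _) (∑-basisˡ j _) ⟩
    0# + f (fsuc j)                                     ≈⟨ +-identityˡ _ ⟩
    f (fsuc j)                                          ∎

  ∑-basisʳ : ∀ {n} (f : Fin n → Carrier) (c : Fin n) → ∑[ j < n ] (f j * basis j c) ≈ f c
  ∑-basisʳ {suc n} f fzero = begin
    f fzero * 1# + ∑[ j < n ] (f (fsuc j) * 0#)  ≈⟨ +-cong (*-identityʳ _) (sum-≈0 _ (λ j → zeroʳ (f (fsuc j)))) ⟩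
    f fzero + 0#                                 ≈⟨ +-identityʳ _ ⟩
    f fzero                                      ∎
  ∑-basisʳ {suc n} f (fsuc c) = begin
    f fzero * 0# + ∑[ j < n ] (f (fsuc j) * basis j c)  ≈⟨ +-cong (zeroʳ _) (∑-basisʳ _ c) ⟩
    0# + f (fsuc c)                                     ≈⟨ +-identityˡ _ ⟩
    f (fsuc c)                                          ∎

  laplace-basis : ∀ {n} (j : Fin (suc n)) (D : Fin (suc n) → Carrier) → laplace (basis j) D ≈ sign (toℕ j) (D j)
  laplace-basis j D = trans (sum-cong-≋ (λ c → sign-*ˡ (toℕ c) (basis j c) (D c))) (∑-basisˡ j (λ c → sign (toℕ c) (D c)))

  det-cong : ∀ n {M M′ : Square n} → (∀ i j → M i j ≈ M′ i j) → det n M ≈ det n M′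
  det-cong zero    _ = refl
  det-cong (suc n) {M} {M′} M≈M′ = begin
    det (suc n) M                                  ≡⟨ det-laplace n M ⟩
    laplace (M fzero) (minors (λ a → M (fsuc a)))
      ≈⟨ laplace-cong (λ j → *-cong (M≈M′ fzero j) (det-cong n (λ a b → M≈M′ (fsuc a) (punchIn j b)))) ⟩
    laplace (M′ fzero) (minors (λ a → M′ (fsuc a))) ≡⟨ det-laplace n M′ ⟨
    det (suc n) M′                                 ∎

  det-linear-row₀ : ∀ n {m} (y : Fin m → Carrier) (w : Fin m → Fin (suc n) → Carrier) (S : Fin n → Fin (suc n) → Carrier) →
    det (suc n) ((λ j → ∑[ k < m ] (y k * w k j)) ∷ S) ≈ ∑[ k < m ] (y k * det (suc n) (w k ∷ S))
  det-linear-row₀ n {m} y w S = begin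
    det (suc n) ((λ j → ∑[ k < m ] (y k * w k j)) ∷ S)  ≡⟨ det-laplace n ((λ j → ∑[ k < m ] (y k * w k j)) ∷ S) ⟩
    laplace (λ j → ∑[ k < m ] (y k * w k j)) (minors S)  ≈⟨ laplace-linearˡ y w (minors S) ⟩
    ∑[ k < m ] (y k * laplace (w k) (minors S))
      ≈⟨ sum-cong-≋ (λ k → *-congˡ {y k} (reflexive (det-laplace n (w k ∷ S)))) ⟨
    ∑[ k < m ] (y k * det (suc n) (w k ∷ S))            ∎

  det-linear-row₁ : ∀ n {m} (u : Fin (suc (suc n)) → Carrier) (y : Fin m → Carrier)
    (w : Fin m → Fin (suc (suc n)) → Carrier) (S : Fin n → Fin (suc (suc n)) → Carrier) →
    det (suc (suc n)) (u ∷ (λ j → ∑[ k < m ] (y k * w k j)) ∷ S) ≈ ∑[ k < m ] (y k * det (suc (suc n)) (u ∷ w k ∷ S))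
  det-linear-row₁ n {m} u y w S = begin
    det (suc (suc n)) (u ∷ row ∷ S)                         ≡⟨ det-laplace (suc n) (u ∷ row ∷ S) ⟩
    laplace u (minors (row ∷ S))                            ≈⟨ laplace-cong (λ j → *-congˡ {u j} (minors-linear j)) ⟩
    laplace u (λ j → ∑[ k < m ] (y k * minors (w k ∷ S) j)) ≈⟨ laplace-linearʳ y u (λ k → minors (w k ∷ S)) ⟩
    ∑[ k < m ] (y k * laplace u (minors (w k ∷ S)))
      ≈⟨ sum-cong-≋ (λ k → *-congˡ {y k} (reflexive (det-laplace (suc n) (u ∷ w k ∷ S)))) ⟨
    ∑[ k < m ] (y k * det (suc (suc n)) (u ∷ w k ∷ S))      ∎
    where
    row : Fin (suc (suc n)) → Carrier
    row j = ∑[ k < m ] (y k * w k j)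
    S′ : Fin (suc (suc n)) → Fin n → Fin (suc n) → Carrier
    S′ j a b = S a (punchIn j b)
    minors-linear : ∀ j → minors (row ∷ S) j ≈ ∑[ k < m ] (y k * minors (w k ∷ S) j)
    minors-linear j = begin
      minors (row ∷ S) j  ≡⟨ det-laplace n (λ a b → (row ∷ S) a (punchIn j b)) ⟩
      laplace (λ b → row (punchIn j b)) (minors (S′ j))
        ≈⟨ laplace-linearˡ y (λ k b → w k (punchIn j b)) (minors (S′ j)) ⟩
      ∑[ k < m ] (y k * laplace (λ b → w k (punchIn j b)) (minors (S′ j)))
        ≈⟨ sum-cong-≋ (λ k → *-congˡ {y k} (reflexive (det-laplace n (λ a b → (w k ∷ S) a (punchIn j b))))) ⟨
      ∑[ k < m ] (y k * minors (w k ∷ S) j)                        ∎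

  basisDet : ∀ {n} → (Fin n → Fin (suc (suc n)) → Carrier) → Fin (suc (suc n)) → Fin (suc (suc n)) → Carrier
  basisDet S j k = det _ (basis j ∷ basis k ∷ S)

  det-bilinear-rows₀₁ : ∀ n (u v : Fin (suc (suc n)) → Carrier) (S : Fin n → Fin (suc (suc n)) → Carrier) →
    det (suc (suc n)) (u ∷ v ∷ S) ≈ ∑[ j < suc (suc n) ] ∑[ k < suc (suc n) ] (u j * (v k * basisDet S j k))
  det-bilinear-rows₀₁ n u v S = begin
    det (suc (suc n)) (u ∷ v ∷ S)
      ≈⟨ det-cong (suc (suc n)) {u ∷ v ∷ S} {(λ c → ∑[ j < _ ] (u j * basis j c)) ∷ v ∷ S}
           (λ { fzero c → sym (∑-basisʳ u c) ; (fsuc i) c → refl }) ⟩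
    det (suc (suc n)) ((λ c → ∑[ j < _ ] (u j * basis j c)) ∷ v ∷ S)
      ≈⟨ det-linear-row₀ (suc n) u basis (v ∷ S) ⟩
    ∑[ j < _ ] (u j * det (suc (suc n)) (basis j ∷ v ∷ S))
      ≈⟨ sum-cong-≋ (λ j → *-congˡ {u j} (expand-row₁ j)) ⟩
    ∑[ j < _ ] (u j * ∑[ k < _ ] (v k * basisDet S j k))
      ≈⟨ sum-cong-≋ (λ j → *-distribˡ-sum (u j) (λ k → v k * basisDet S j k)) ⟩
    ∑[ j < _ ] ∑[ k < _ ] (u j * (v k * basisDet S j k)) ∎
    where
    expand-row₁ : ∀ j → det (suc (suc n)) (basis j ∷ v ∷ S) ≈ ∑[ k < _ ] (v k * basisDet S j k)
    expand-row₁ j = trans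
      (det-cong (suc (suc n)) {basis j ∷ v ∷ S} {basis j ∷ (λ c → ∑[ k < _ ] (v k * basis k c)) ∷ S}
        (λ { fzero c → refl ; (fsuc fzero) c → sym (∑-basisʳ v c) ; (fsuc (fsuc i)) c → refl }))
      (det-linear-row₁ n (basis j) v basis S)

  det-basis-row₀ : ∀ n (j : Fin (suc n)) (S : Fin n → Fin (suc n) → Carrier) →
    det (suc n) (basis j ∷ S) ≈ sign (toℕ j) (minors S j)
  det-basis-row₀ n j S = trans (reflexive (det-laplace n (basis j ∷ S))) (laplace-basis j (minors S))

  basisDet-punchIn : ∀ n (S : Fin n → Fin (suc (suc n)) → Carrier) (j : Fin (suc (suc n))) (k′ : Fin (suc n)) →
    basisDet S j (punchIn j k′) ≈ sign (toℕ j ℕ.+ toℕ k′) (det n (λ a b → S a (punchIn j (punchIn k′ b))))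
  basisDet-punchIn n S j k′ = begin
    basisDet S j (punchIn j k′)
      ≈⟨ det-basis-row₀ (suc n) j (basis (punchIn j k′) ∷ S) ⟩
    sign (toℕ j) (minors (basis (punchIn j k′) ∷ S) j)
      ≡⟨ ≡.cong (sign (toℕ j)) (det-laplace n (λ a b → (basis (punchIn j k′) ∷ S) a (punchIn j b))) ⟩
    sign (toℕ j) (laplace (λ b → basis (punchIn j k′) (punchIn j b)) (minors S′))
      ≈⟨ sign-cong (toℕ j) (laplace-cong {D = minors S′} {D′ = minors S′}
                                          (λ b → *-congʳ (reflexive (basis-punchIn j k′ b)))) ⟩
    sign (toℕ j) (laplace (basis k′) (minors S′))
      ≈⟨ sign-cong (toℕ j) (laplace-basis k′ (minors S′)) ⟩
    sign (toℕ j) (sign (toℕ k′) (minors S′ k′))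
      ≡⟨ sign-+ (toℕ j) (toℕ k′) _ ⟩
    sign (toℕ j ℕ.+ toℕ k′) (det n (λ a b → S a (punchIn j (punchIn k′ b)))) ∎
    where
    S′ : Fin n → Fin (suc n) → Carrier
    S′ a b = S a (punchIn j b)

  basisDet-diagonal : ∀ n (S : Fin n → Fin (suc (suc n)) → Carrier) (j : Fin (suc (suc n))) → basisDet S j j ≈ 0#
  basisDet-diagonal n S j = begin
    basisDet S j j
      ≈⟨ det-basis-row₀ (suc n) j (basis j ∷ S) ⟩
    sign (toℕ j) (minors (basis j ∷ S) j)
      ≡⟨ ≡.cong (sign (toℕ j)) (det-laplace n (λ a b → (basis j ∷ S) a (punchIn j b))) ⟩
    sign (toℕ j) (laplace (λ b → basis j (punchIn j b)) (minors (λ a b → S a (punchIn j b))))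
      ≈⟨ sign-cong (toℕ j) (laplace-≈0 {D = minors (λ a b → S a (punchIn j b))}
                                         (λ b → trans (*-congʳ (reflexive (basis-punchIn-self j b))) (zeroˡ _))) ⟩
    sign (toℕ j) 0#
      ≈⟨ sign-0# (toℕ j) ⟩
    0# ∎

  -- Both sides reduce to the same minor (columns j and k deleted); the two sign exponents differ by one.
  basisDet-antisym : ∀ n (S : Fin n → Fin (suc (suc n)) → Carrier) j k → basisDet S j k ≈ - basisDet S k j
  basisDet-antisym n S j l with j Fin.≟ l
  ... | yes ≡.refl = trans (basisDet-diagonal n S j) (trans (sym -0#≈0#) (-‿cong (sym (basisDet-diagonal n S j))))
  ... | no j≢l = ≡.subst (λ t → basisDet S j t ≈ - basisDet S t j) (punchIn-punchOut j≢l) (antisym-punchIn (punchOut j≢l))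
    where
    antisym-punchIn : ∀ k′ → basisDet S j (punchIn j k′) ≈ - basisDet S (punchIn j k′) j
    antisym-punchIn k′ = begin
      basisDet S j (punchIn j k′)
        ≈⟨ basisDet-punchIn n S j k′ ⟩
      sign (toℕ j ℕ.+ toℕ k′) (det n (λ a b → S a (punchIn j (punchIn k′ b))))
        ≈⟨ sign-adjacent _ (partner-parity j k′) ⟩
      - sign (toℕ k ℕ.+ toℕ j′) (det n (λ a b → S a (punchIn j (punchIn k′ b))))
        ≈⟨ -‿cong (sign-cong (toℕ k ℕ.+ toℕ j′)
                   (det-cong n (λ a b → reflexive (≡.cong (S a) (punchIn-punchIn-partner j k′ b))))) ⟩
      - sign (toℕ k ℕ.+ toℕ j′) (det n (λ a b → S a (punchIn k (punchIn j′ b))))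
        ≈⟨ -‿cong (basisDet-punchIn n S k j′) ⟨
      - basisDet S k (punchIn k j′)
        ≡⟨ ≡.cong (λ t → - basisDet S k t) (punchIn-partner j k′) ⟩
      - basisDet S k j ∎
      where
      k : Fin (suc (suc n))
      k = punchIn j k′
      j′ : Fin (suc n)
      j′ = partner j k′

  ∑∑-antisymmetric : ∀ {n} (a : Fin n → Fin n → Carrier) → (∀ j → a j j ≈ 0#) → (∀ j k → a j k ≈ - a k j) →
    ∑[ j < n ] ∑[ k < n ] a j k ≈ 0#
  ∑∑-antisymmetric {zero}  a diag anti = refl
  ∑∑-antisymmetric {suc n} a diag anti = begin
    (a fzero fzero + row₀) + ∑[ j < n ] (a (fsuc j) fzero + ∑[ k < n ] a (fsuc j) (fsuc k))
      ≈⟨ +-cong (+-congʳ (diag fzero)) (∑-distrib-+ (λ j → a (fsuc j) fzero) (λ j → ∑[ k < n ] a (fsuc j) (fsuc k))) ⟩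
    (0# + row₀) + (column₀ + ∑[ j < n ] ∑[ k < n ] a (fsuc j) (fsuc k))
      ≈⟨ +-cong (+-identityˡ row₀)
                (+-congˡ (∑∑-antisymmetric (λ j k → a (fsuc j) (fsuc k)) (diag ∘ fsuc) (λ j k → anti (fsuc j) (fsuc k)))) ⟩
    row₀ + (column₀ + 0#)
      ≈⟨ +-congˡ (+-identityʳ column₀) ⟩
    row₀ + column₀
      ≈⟨ ∑-distrib-+ (λ k → a fzero (fsuc k)) (λ k → a (fsuc k) fzero) ⟨
    ∑[ k < n ] (a fzero (fsuc k) + a (fsuc k) fzero)
      ≈⟨ sum-≈0 _ (λ k → trans (+-congˡ (anti (fsuc k) fzero)) (-‿inverseʳ _)) ⟩
    0# ∎
    where
    row₀ = ∑[ k < n ] a fzero (fsuc k)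
    column₀ = ∑[ j < n ] a (fsuc j) fzero

  module AlternatingForm {n} (E : Fin n → Fin n → Carrier)
                         (E-diagonal : ∀ j → E j j ≈ 0#) (E-antisym : ∀ j k → E j k ≈ - E k j) where

    form : (Fin n → Carrier) → (Fin n → Carrier) → Carrier
    form x y = ∑[ j < n ] ∑[ k < n ] (x j * (y k * E j k))

    private
      term-diagonal : ∀ p q j → p * (q * E j j) ≈ 0#
      term-diagonal p q j = trans (*-congˡ (trans (*-congˡ (E-diagonal j)) (zeroʳ q))) (zeroʳ p)

      term-antisym : ∀ p q j k → p * (q * E j k) ≈ - (q * (p * E k j))
      term-antisym p q j k = begin
        p * (q * E j k)    ≈⟨ *-congˡ (*-congˡ (E-antisym j k)) ⟩
        p * (q * - E k j)  ≈⟨ *-congˡ (-‿distribʳ-* q (E k j)) ⟨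
        p * - (q * E k j)  ≈⟨ -‿distribʳ-* p _ ⟨
        - (p * (q * E k j)) ≈⟨ -‿cong (x∙yz≈y∙xz p q (E k j)) ⟩
        - (q * (p * E k j)) ∎

    form-alternating : ∀ x → form x x ≈ 0#
    form-alternating x = ∑∑-antisymmetric (λ j k → x j * (x k * E j k))
      (λ j → term-diagonal (x j) (x j) j) (λ j k → term-antisym (x j) (x k) j k)

    form-skew : ∀ x y → form x y ≈ - form y x
    form-skew x y = +-inverseˡ-unique _ _ (begin
      form x y + form y x
        ≈⟨ ∑-distrib-+ (λ j → ∑[ k < n ] (x j * (y k * E j k))) (λ j → ∑[ k < n ] (y j * (x k * E j k))) ⟨
      ∑[ j < n ] (∑[ k < n ] (x j * (y k * E j k)) + ∑[ k < n ] (y j * (x k * E j k)))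
        ≈⟨ sum-cong-≋ (λ j → ∑-distrib-+ (λ k → x j * (y k * E j k)) (λ k → y j * (x k * E j k))) ⟨
      ∑[ j < n ] ∑[ k < n ] a j k
        ≈⟨ ∑∑-antisymmetric a diag anti ⟩
      0# ∎)
      where
      a : Fin n → Fin n → Carrier
      a j k = x j * (y k * E j k) + y j * (x k * E j k)
      diag : ∀ j → a j j ≈ 0#
      diag j = trans (+-cong (term-diagonal (x j) (y j) j) (term-diagonal (y j) (x j) j)) (+-identityʳ 0#)
      anti : ∀ j k → a j k ≈ - a k j
      anti j k = begin
        a j k                                                    ≈⟨ +-cong (term-antisym (x j) (y k) j k) (term-antisym (y j) (x k) j k) ⟩
        - (y k * (x j * E k j)) + - (x k * (y j * E k j))        ≈⟨ -‿+-comm _ _ ⟩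
        - (y k * (x j * E k j) + x k * (y j * E k j))            ≈⟨ -‿cong (+-comm _ _) ⟩
        - a k j                                                  ∎

  module _ (n : ℕ) (S : Fin n → Fin (suc (suc n)) → Carrier) where
    open AlternatingForm (basisDet S) (basisDet-diagonal n S) (basisDet-antisym n S)

    det-equal-rows₀₁ : ∀ x → det (suc (suc n)) (x ∷ x ∷ S) ≈ 0#
    det-equal-rows₀₁ x = trans (det-bilinear-rows₀₁ n x x S) (form-alternating x)

    det-swap-rows₀₁ : ∀ x y → det (suc (suc n)) (x ∷ y ∷ S) ≈ - det (suc (suc n)) (y ∷ x ∷ S)
    det-swap-rows₀₁ x y = begin
      det (suc (suc n)) (x ∷ y ∷ S)    ≈⟨ det-bilinear-rows₀₁ n x y S ⟩
      form x y                         ≈⟨ form-skew x y ⟩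
      - form y x                       ≈⟨ -‿cong (det-bilinear-rows₀₁ n y x S) ⟨
      - det (suc (suc n)) (y ∷ x ∷ S)  ∎

  det-minors-≈0 : ∀ n (M : Square (suc n)) → (∀ j → minors (λ a → M (fsuc a)) j ≈ 0#) → det (suc n) M ≈ 0#
  det-minors-≈0 n M minors≈0 =
    trans (reflexive (det-laplace n M)) (laplace-≈0 {v = M fzero} (λ j → trans (*-congˡ (minors≈0 j)) (zeroʳ _)))

  det-equal-rows : ∀ n (M : Square n) {i l : Fin n} → i Fin.< l → (∀ c → M i c ≈ M l c) → det n M ≈ 0#
  det-equal-rows (suc n) M {fsuc i} {fsuc l} (s≤s i<l) eq =
    det-minors-≈0 n M (λ j → det-equal-rows n (λ a b → M (fsuc a) (punchIn j b)) i<l (λ b → eq (punchIn j b)))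
  det-equal-rows (suc (suc n)) M {fzero} {fsuc fzero} _ eq = begin
    det (suc (suc n)) M                      ≈⟨ det-cong (suc (suc n)) {M} {M₁ ∷ M₁ ∷ rest}
                                                  (λ { fzero c → eq c ; (fsuc fzero) c → refl ; (fsuc (fsuc a)) c → refl }) ⟩
    det (suc (suc n)) (M₁ ∷ M₁ ∷ rest)       ≈⟨ det-equal-rows₀₁ n rest M₁ ⟩
    0#                                       ∎
    where
    M₁ : Fin (suc (suc n)) → Carrier
    M₁ = M (fsuc fzero)
    rest : Fin n → Fin (suc (suc n)) → Carrier
    rest a = M (fsuc (fsuc a))
  det-equal-rows (suc (suc n)) M {fzero} {fsuc (fsuc l)} _ eq = begin
    det (suc (suc n)) M                      ≈⟨ det-cong (suc (suc n)) {M} {M₀ ∷ M₁ ∷ rest}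
                                                  (λ { fzero c → refl ; (fsuc fzero) c → refl ; (fsuc (fsuc a)) c → refl }) ⟩
    det (suc (suc n)) (M₀ ∷ M₁ ∷ rest)       ≈⟨ det-swap-rows₀₁ n rest M₀ M₁ ⟩
    - det (suc (suc n)) (M₁ ∷ M₀ ∷ rest)     ≈⟨ -‿cong (det-minors-≈0 (suc n) (M₁ ∷ M₀ ∷ rest) (λ j →
                                                  det-equal-rows (suc n) (λ a b → (M₀ ∷ rest) a (punchIn j b)) {fzero} {fsuc l}
                                                    (s≤s z≤n) (λ b → eq (punchIn j b)))) ⟩
    - 0#                                     ≈⟨ -0#≈0# ⟩
    0#                                       ∎
    where
    M₀ M₁ : Fin (suc (suc n)) → Carrier
    M₀ = M fzero
    M₁ = M (fsuc fzero)
    rest : Fin n → Fin (suc (suc n)) → Carrier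
    rest a = M (fsuc (fsuc a))

  det-lowerTriangular : ∀ n (B : Square n) → (∀ {i j} → i Fin.< j → B i j ≈ 0#) → det n B ≈ product (λ i → B i i)
  det-lowerTriangular zero    B lower = refl
  det-lowerTriangular (suc n) B lower = begin
    det (suc n) B
      ≡⟨ det-laplace n B ⟩
    B fzero fzero * det n B′ + ∑[ j < n ] sign (suc (toℕ j)) (B fzero (fsuc j) * minors (λ a → B (fsuc a)) (fsuc j))
      ≈⟨ +-cong (*-congˡ (det-lowerTriangular n B′ (λ i<j → lower (s≤s i<j))))
                (sum-≈0 (λ j → sign (suc (toℕ j)) (B fzero (fsuc j) * minors (λ a → B (fsuc a)) (fsuc j))) first-row) ⟩
    B fzero fzero * product (λ i → B′ i i) + 0#
      ≈⟨ +-identityʳ _ ⟩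
    product (λ i → B i i) ∎
    where
    B′ : Square n
    B′ a b = B (fsuc a) (fsuc b)
    first-row : ∀ j → sign (suc (toℕ j)) (B fzero (fsuc j) * minors (λ a → B (fsuc a)) (fsuc j)) ≈ 0#
    first-row j = trans (sign-cong (suc (toℕ j)) (trans (*-congʳ (lower (s≤s z≤n))) (zeroˡ _))) (sign-0# (suc (toℕ j)))

  det-upperTriangular-* : ∀ n (A X : Square n) → (∀ {i m} → m Fin.< i → A i m ≈ 0#) →
    det n (λ i j → ∑[ m < n ] (A i m * X m j)) ≈ product (λ i → A i i) * det n X
  det-upperTriangular-* zero    A X upper = sym (*-identityˡ 1#)
  det-upperTriangular-* (suc n) A X upper = begin
    det (suc n) AX
      ≡⟨ det-laplace n AX ⟩
    laplace (AX fzero) (minors (λ a → AX (fsuc a)))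
      ≈⟨ laplace-cong (λ j → *-congˡ {AX fzero j} (minors-step j)) ⟩
    laplace (AX fzero) (λ j → P′ * minors X′ j)
      ≈⟨ laplace-*ʳ P′ (AX fzero) (minors X′) ⟩
    P′ * laplace (λ j → ∑[ m < suc n ] (A fzero m * X m j)) (minors X′)
      ≈⟨ *-congˡ (laplace-linearˡ (A fzero) X (minors X′)) ⟩
    P′ * (A fzero fzero * laplace (X fzero) (minors X′) + ∑[ m < n ] (A fzero (fsuc m) * laplace (X (fsuc m)) (minors X′)))
      ≈⟨ *-congˡ (+-cong (*-congˡ (reflexive (≡.sym (det-laplace n X))))
                         (sum-≈0 (λ m → A fzero (fsuc m) * laplace (X (fsuc m)) (minors X′))
                                 (λ m → trans (*-congˡ (repeated-row m)) (zeroʳ _)))) ⟩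
    P′ * (A fzero fzero * det (suc n) X + 0#)
      ≈⟨ *-congˡ (+-identityʳ _) ⟩
    P′ * (A fzero fzero * det (suc n) X)
      ≈⟨ x∙yz≈y∙xz P′ (A fzero fzero) (det (suc n) X) ⟩
    A fzero fzero * (P′ * det (suc n) X)
      ≈⟨ *-assoc _ _ _ ⟨
    product (λ i → A i i) * det (suc n) X ∎
    where
    AX : Square (suc n)
    AX i j = ∑[ m < suc n ] (A i m * X m j)
    X′ : Fin n → Fin (suc n) → Carrier
    X′ a = X (fsuc a)
    A′ : Square n
    A′ a m = A (fsuc a) (fsuc m)
    P′ : Carrier
    P′ = product (λ i → A′ i i)
    minors-step : ∀ j → minors (λ a → AX (fsuc a)) j ≈ P′ * minors X′ j
    minors-step j = trans
      (det-cong n {λ a b → AX (fsuc a) (punchIn j b)} {λ a b → ∑[ m < n ] (A′ a m * X′ m (punchIn j b))}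
        (λ a b → trans (+-congʳ (trans (*-congʳ (upper (s≤s z≤n))) (zeroˡ _))) (+-identityˡ _)))
      (det-upperTriangular-* n A′ (λ a b → X′ a (punchIn j b)) (λ m<i → upper (s≤s m<i)))
    repeated-row : ∀ m → laplace (X (fsuc m)) (minors X′) ≈ 0#
    repeated-row m = trans (reflexive (≡.sym (det-laplace n (X (fsuc m) ∷ X′))))
      (det-equal-rows (suc n) (X (fsuc m) ∷ X′) {fzero} {fsuc m} (s≤s z≤n) (λ c → refl))

module RangeSums {c ℓ : Level} (R : CommutativeRing c ℓ) where
  open CommutativeRing R
  open Tridiag R using (sumℕ; δ)
  open import Algebra.Properties.Semiring.Sum semiring using (sum-syntax)
  open import Algebra.Properties.CommutativeSemigroup +-commutativeSemigroup using (interchange)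
  open import Relation.Binary.Reasoning.Setoid setoid

  sumℕ-cong : ∀ n {f g : ℕ → Carrier} → (∀ m → m ℕ.< n → f m ≈ g m) → sumℕ n f ≈ sumℕ n g
  sumℕ-cong zero    f≈g = refl
  sumℕ-cong (suc n) f≈g = +-cong (sumℕ-cong n (λ m m<n → f≈g m (ℕ.m<n⇒m<1+n m<n))) (f≈g n (ℕ.n<1+n n))

  sumℕ-≈0 : ∀ n {f : ℕ → Carrier} → (∀ m → m ℕ.< n → f m ≈ 0#) → sumℕ n f ≈ 0#
  sumℕ-≈0 zero    f≈0 = refl
  sumℕ-≈0 (suc n) f≈0 =
    trans (+-cong (sumℕ-≈0 n (λ m m<n → f≈0 m (ℕ.m<n⇒m<1+n m<n))) (f≈0 n (ℕ.n<1+n n))) (+-identityʳ 0#)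

  sumℕ-+ : ∀ n (f g : ℕ → Carrier) → sumℕ n (λ i → f i + g i) ≈ sumℕ n f + sumℕ n g
  sumℕ-+ zero    f g = sym (+-identityʳ 0#)
  sumℕ-+ (suc n) f g = trans (+-congʳ (sumℕ-+ n f g)) (interchange _ _ _ _)

  sumℕ-*ˡ : ∀ n a (f : ℕ → Carrier) → sumℕ n (λ i → a * f i) ≈ a * sumℕ n f
  sumℕ-*ˡ zero    a f = sym (zeroʳ a)
  sumℕ-*ˡ (suc n) a f = trans (+-congʳ (sumℕ-*ˡ n a f)) (sym (distribˡ a _ _))

  sumℕ-*ʳ : ∀ n a (f : ℕ → Carrier) → sumℕ n (λ i → f i * a) ≈ sumℕ n f * a
  sumℕ-*ʳ zero    a f = sym (zeroˡ a)
  sumℕ-*ʳ (suc n) a f = trans (+-congʳ (sumℕ-*ʳ n a f)) (sym (distribʳ a _ _))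

  sumℕ-comm : ∀ n m (f : ℕ → ℕ → Carrier) → sumℕ n (λ i → sumℕ m (f i)) ≈ sumℕ m (λ j → sumℕ n (λ i → f i j))
  sumℕ-comm zero    m f = sym (sumℕ-≈0 m (λ _ _ → refl))
  sumℕ-comm (suc n) m f = trans (+-congʳ (sumℕ-comm n m f)) (sym (sumℕ-+ m _ (f n)))

  sumℕ-truncate : ∀ {n n′} (f : ℕ → Carrier) → n ℕ.≤ n′ → (∀ m → n ℕ.≤ m → f m ≈ 0#) →
    sumℕ n′ f ≈ sumℕ n f
  sumℕ-truncate {n} {n′} f n≤n′ f≈0 =
    trans (reflexive (≡.cong (λ t → sumℕ t f) (≡.sym (ℕ.m∸n+n≡m n≤n′)))) (extend (n′ ∸ n))
    where
    extend : ∀ d → sumℕ (d ℕ.+ n) f ≈ sumℕ n f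
    extend zero    = refl
    extend (suc d) = trans (+-cong (extend d) (f≈0 (d ℕ.+ n) (ℕ.m≤n+m n d))) (+-identityʳ _)

  sumℕ-resize : ∀ {n n′} (f : ℕ → Carrier) → (∀ m → n ℕ.≤ m → f m ≈ 0#) → (∀ m → n′ ℕ.≤ m → f m ≈ 0#) →
    sumℕ n f ≈ sumℕ n′ f
  sumℕ-resize {n} {n′} f f≈0 f≈0′ =
    trans (sym (sumℕ-truncate f (ℕ.m≤m+n n n′) f≈0)) (sumℕ-truncate f (ℕ.m≤n+m n′ n) f≈0′)

  sumℕ-reverse : ∀ r (g : ℕ → Carrier) → sumℕ (suc r) g ≈ ∑[ m < suc r ] g (r ∸ toℕ m)
  sumℕ-reverse zero    g = trans (+-identityˡ _) (sym (+-identityʳ _))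
  sumℕ-reverse (suc r) g = trans (+-congʳ (sumℕ-reverse r g)) (+-comm _ _)

  δ-refl : ∀ i → δ i i ≡ 1#
  δ-refl zero    = ≡.refl
  δ-refl (suc i) = δ-refl i

  δ-≢ : ∀ {i j} → ¬ i ≡ j → δ i j ≡ 0#
  δ-≢ {zero}  {zero}  i≢j = ⊥-elim (i≢j ≡.refl)
  δ-≢ {zero}  {suc j} i≢j = ≡.refl
  δ-≢ {suc i} {zero}  i≢j = ≡.refl
  δ-≢ {suc i} {suc j} i≢j = δ-≢ (i≢j ∘ ≡.cong suc)

  δ-sym : ∀ i j → δ i j ≡ δ j i
  δ-sym zero    zero    = ≡.refl
  δ-sym zero    (suc j) = ≡.refl
  δ-sym (suc i) zero    = ≡.refl
  δ-sym (suc i) (suc j) = δ-sym i j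

  sumℕ-δʳ : ∀ n j (f : ℕ → Carrier) → j ℕ.< n → sumℕ n (λ p → f p * δ p j) ≈ f j
  sumℕ-δʳ (suc n) j f j<1+n with ℕ.m≤n⇒m<n∨m≡n (ℕ.≤-pred j<1+n)
  ... | inj₁ j<n = trans (+-cong (sumℕ-δʳ n j f j<n) (trans (*-congˡ (reflexive (δ-≢ (ℕ.<⇒≢ j<n ∘ ≡.sym)))) (zeroʳ _)))
                         (+-identityʳ _)
  ... | inj₂ ≡.refl = trans (+-cong (sumℕ-≈0 n (λ m m<n → trans (*-congˡ (reflexive (δ-≢ (ℕ.<⇒≢ m<n)))) (zeroʳ _)))
                                    (trans (*-congˡ (reflexive (δ-refl n))) (*-identityʳ _)))
                            (+-identityˡ _)

  sumℕ-δˡ : ∀ n j (f : ℕ → Carrier) → j ℕ.< n → sumℕ n (λ p → δ j p * f p) ≈ f j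
  sumℕ-δˡ n j f j<n =
    trans (sumℕ-cong n (λ p _ → trans (*-comm _ _) (*-congˡ (reflexive (δ-sym j p))))) (sumℕ-δʳ n j f j<n)

module MotzkinPaths {c ℓ : Level} (R : CommutativeRing c ℓ) (C : Tridiag.Matrix R) where
  open CommutativeRing R
  open Tridiag R
  open RangeSums R using (δ-refl; δ-≢)
  open import Algebra.Solver.CommutativeMonoid +-commutativeMonoid using (solve; _⊕_; _⊜_)
  open import Data.List using (List; []; _∷_; map; concatMap)
  open import Data.Maybe using (just; nothing)

  downStep : (ℕ → Carrier) → ℕ → Carrier
  downStep f zero    = 0#
  downStep f (suc h) = C (suc h) h * f h

  successorsSum : (ℕ → Carrier) → ℕ → Carrier
  successorsSum f h = C h (suc h) * f (suc h) + (C h h * f h + downStep f h)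

  successorsSum-cong : ∀ {f g : ℕ → Carrier} h → (∀ h′ → f h′ ≈ g h′) → successorsSum f h ≈ successorsSum g h
  successorsSum-cong zero    f≈g = +-cong (*-congˡ (f≈g 1)) (+-congʳ (*-congˡ (f≈g 0)))
  successorsSum-cong (suc h) f≈g = +-cong (*-congˡ (f≈g (suc (suc h)))) (+-cong (*-congˡ (f≈g (suc h))) (*-congˡ (f≈g h)))

  motzkinFrom : ℕ → ℕ → ℕ → Carrier
  motzkinFrom h N r = sumList (map (λ s → endsAt (endFrom h s) r (weightFrom C h s)) (allSteps N))

  sumList-map-cong : ∀ {A : Set} (l : List A) {f g : A → Carrier} → (∀ s → f s ≈ g s) → sumList (map f l) ≈ sumList (map g l)
  sumList-map-cong []      f≈g = refl
  sumList-map-cong (s ∷ l) f≈g = +-cong (f≈g s) (sumList-map-cong l f≈g)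

  sumList-map-*ˡ : ∀ {A : Set} (l : List A) a (f : A → Carrier) → sumList (map (λ s → a * f s) l) ≈ a * sumList (map f l)
  sumList-map-*ˡ []      a f = sym (zeroʳ a)
  sumList-map-*ˡ (s ∷ l) a f = trans (+-congˡ (sumList-map-*ˡ l a f)) (sym (distribˡ a _ _))

  sumList-map-≈0 : ∀ {A : Set} (l : List A) {f : A → Carrier} → (∀ s → f s ≈ 0#) → sumList (map f l) ≈ 0#
  sumList-map-≈0 []      f≈0 = refl
  sumList-map-≈0 (s ∷ l) f≈0 = trans (+-cong (f≈0 s) (sumList-map-≈0 l f≈0)) (+-identityʳ 0#)

  sumList-map-extensions : ∀ (l : List (List Step)) (g : List Step → Carrier) →
    sumList (map g (concatMap (λ s → (up ∷ s) ∷ (flat ∷ s) ∷ (down ∷ s) ∷ []) l))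
      ≈ sumList (map (g ∘ (up ∷_)) l) + (sumList (map (g ∘ (flat ∷_)) l) + sumList (map (g ∘ (down ∷_)) l))
  sumList-map-extensions []      g = sym (trans (+-identityˡ _) (+-identityˡ _))
  sumList-map-extensions (s ∷ l) g = trans (+-congˡ (+-congˡ (+-congˡ (sumList-map-extensions l g))))
    (solve 6 (λ a b c p q t → a ⊕ (b ⊕ (c ⊕ (p ⊕ (q ⊕ t)))) ⊜ (a ⊕ p) ⊕ ((b ⊕ q) ⊕ (c ⊕ t))) refl _ _ _ _ _ _)

  endsAt-*ˡ : ∀ e r a w → endsAt e r (a * w) ≈ a * endsAt e r w
  endsAt-*ˡ nothing  r a w = sym (zeroʳ a)
  endsAt-*ˡ (just h) r a w with h ℕ.≟ r
  ... | yes _ = refl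
  ... | no  _ = sym (zeroʳ a)

  motzkinFrom-zero : ∀ h r → motzkinFrom h 0 r ≈ δ h r
  motzkinFrom-zero h r with h ℕ.≟ r
  ... | yes ≡.refl = trans (+-identityʳ _) (sym (reflexive (δ-refl h)))
  ... | no  h≢r    = trans (+-identityʳ _) (sym (reflexive (δ-≢ h≢r)))

  motzkinFrom-suc : ∀ h N r → motzkinFrom h (suc N) r ≈ successorsSum (λ h′ → motzkinFrom h′ N r) h
  motzkinFrom-suc h N r =
    trans (sumList-map-extensions (allSteps N) path) (+-cong (step (suc h) _) (+-cong (step h _) (stepDown h)))
    where
    path : List Step → Carrier
    path s = endsAt (endFrom h s) r (weightFrom C h s)
    step : ∀ h′ a → sumList (map (λ s → endsAt (endFrom h′ s) r (a * weightFrom C h′ s)) (allSteps N)) ≈ a * motzkinFrom h′ N r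
    step h′ a = trans (sumList-map-cong (allSteps N) (λ s → endsAt-*ˡ (endFrom h′ s) r a _)) (sumList-map-*ˡ (allSteps N) a _)
    stepDown : ∀ h → sumList (map (λ s → endsAt (endFrom h (down ∷ s)) r (weightFrom C h (down ∷ s))) (allSteps N))
                      ≈ downStep (λ h′ → motzkinFrom h′ N r) h
    stepDown zero    = sumList-map-≈0 (allSteps N) (λ s → refl)
    stepDown (suc h) = step h _

module MatrixPowers {c ℓ : Level} (R : CommutativeRing c ℓ) (C : Tridiag.Matrix R) (tri : Tridiag.IsTridiagonal R C) where
  open CommutativeRing R
  open Tridiag R
  open RangeSums R
  open MotzkinPaths R C
  open import Algebra.Solver.CommutativeMonoid +-commutativeMonoid using (solve; _⊕_; _⊜_; id)
  open import Relation.Binary.Reasoning.Setoid setoid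

  C-above : ∀ {m j} → suc m ℕ.< j → C m j ≈ 0#
  C-above {m} {j} lt = tri m j (inj₁ lt)

  C-below : ∀ {m j} → suc j ℕ.< m → C m j ≈ 0#
  C-below {m} {j} lt = tri m j (inj₂ lt)

  pow-vanishes-above : ∀ k {i j} → i ℕ.+ k ℕ.< j → pow C k i j ≈ 0#
  pow-vanishes-above zero    {i} {j} lt = reflexive (δ-≢ (ℕ.<⇒≢ (≡.subst (ℕ._< j) (ℕ.+-identityʳ i) lt)))
  pow-vanishes-above (suc k) {i} {j} lt = sumℕ-≈0 (suc (i ℕ.+ k)) (λ m m≤i+k →
    trans (*-congˡ (C-above (ℕ.<-≤-trans (s≤s m≤i+k) (≡.subst (ℕ._< j) (ℕ.+-suc i k) lt)))) (zeroʳ _))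

  pow-vanishes-below : ∀ k {i j} → j ℕ.+ k ℕ.< i → pow C k i j ≈ 0#
  pow-vanishes-below zero    {i} {j} lt = reflexive (δ-≢ (ℕ.<⇒≢ (≡.subst (ℕ._< i) (ℕ.+-identityʳ j) lt) ∘ ≡.sym))
  pow-vanishes-below (suc k) {i} {j} lt = sumℕ-≈0 (suc (i ℕ.+ k)) term
    where
    term : ∀ m → m ℕ.< suc (i ℕ.+ k) → pow C k i m * C m j ≈ 0#
    term m _ with m ℕ.+ k ℕ.<? i
    ... | yes m+k<i = trans (*-congʳ (pow-vanishes-below k m+k<i)) (zeroˡ _)
    ... | no  m+k≮i = trans (*-congˡ (C-below (ℕ.+-cancelʳ-< k (suc j) m j+1+k<m+k))) (zeroʳ _)
      where
      j+1+k<m+k : suc j ℕ.+ k ℕ.< m ℕ.+ k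
      j+1+k<m+k = ℕ.<-≤-trans (≡.subst (ℕ._< i) (ℕ.+-suc j k) lt) (ℕ.≮⇒≥ m+k≮i)

  pow-+ : ∀ a b i j → pow C (a ℕ.+ b) i j ≈ sumℕ (suc (i ℕ.+ a)) (λ p → pow C a i p * pow C b p j)
  pow-+ a zero i j rewrite ℕ.+-identityʳ a with j ℕ.<? suc (i ℕ.+ a)
  ... | yes j≤i+a = sym (sumℕ-δʳ (suc (i ℕ.+ a)) j (pow C a i) j≤i+a)
  ... | no  j≰i+a = trans (pow-vanishes-above a (ℕ.≮⇒≥ j≰i+a)) (sym (sumℕ-≈0 (suc (i ℕ.+ a)) (λ p p≤i+a →
    trans (*-congˡ (reflexive (δ-≢ (λ p≡j → j≰i+a (≡.subst (ℕ._< suc (i ℕ.+ a)) p≡j p≤i+a))))) (zeroʳ _))))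
  pow-+ a (suc b) i j rewrite ℕ.+-suc a b = begin
    sumℕ M (λ m → pow C (a ℕ.+ b) i m * C m j)
      ≈⟨ sumℕ-cong M (λ m _ → *-congʳ (pow-+ a b i m)) ⟩
    sumℕ M (λ m → sumℕ K (λ p → pow C a i p * pow C b p m) * C m j)
      ≈⟨ sumℕ-cong M (λ m _ → trans (sym (sumℕ-*ʳ K (C m j) _)) (sumℕ-cong K (λ p _ → *-assoc _ _ _))) ⟩
    sumℕ M (λ m → sumℕ K (λ p → pow C a i p * (pow C b p m * C m j)))
      ≈⟨ sumℕ-comm M K _ ⟩
    sumℕ K (λ p → sumℕ M (λ m → pow C a i p * (pow C b p m * C m j)))
      ≈⟨ sumℕ-cong K (λ p p<K → trans (sumℕ-*ˡ M (pow C a i p) _) (*-congˡ (row-support p p<K))) ⟩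
    sumℕ K (λ p → pow C a i p * pow C (suc b) p j) ∎
    where
    M K : ℕ
    M = suc (i ℕ.+ (a ℕ.+ b))
    K = suc (i ℕ.+ a)
    row-support : ∀ p → p ℕ.< K → sumℕ M (λ m → pow C b p m * C m j) ≈ sumℕ (suc (p ℕ.+ b)) (λ m → pow C b p m * C m j)
    row-support p p<K = sumℕ-truncate (λ m → pow C b p m * C m j)
      (s≤s (≡.subst (p ℕ.+ b ℕ.≤_) (ℕ.+-assoc i a b) (ℕ.+-monoˡ-≤ b (ℕ.≤-pred p<K))))
      (λ m p+b<m → trans (*-congʳ (pow-vanishes-above b p+b<m)) (zeroˡ _))

  pow-one : ∀ h p → pow C 1 h p ≈ C h p
  pow-one h p = sumℕ-δˡ (suc (h ℕ.+ 0)) h (λ m → C m p) (s≤s (ℕ.m≤m+n h 0))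

  pow-diagonal : ∀ k → pow C k 0 k ≈ kr C k
  pow-diagonal zero    = refl
  pow-diagonal (suc k) = trans
    (+-cong (sumℕ-≈0 k (λ m m<k → trans (*-congˡ (C-above (s≤s m<k))) (zeroʳ _))) (*-congʳ (pow-diagonal k)))
    (+-identityˡ _)

  tridiagonal-row-sum : ∀ h (P : ℕ → Carrier) → sumℕ (suc (suc h)) (λ p → C h p * P p) ≈ successorsSum P h
  tridiagonal-row-sum zero    P = solve 2 (λ a b → (id ⊕ a) ⊕ b ⊜ b ⊕ (a ⊕ id)) refl _ _
  tridiagonal-row-sum (suc h) P = trans
    (+-congʳ (+-congʳ (+-congʳ (sumℕ-≈0 h (λ p p<h → trans (*-congʳ (C-below (s≤s p<h))) (zeroˡ _))))))
    (solve 3 (λ a b c → ((id ⊕ a) ⊕ b) ⊕ c ⊜ c ⊕ (b ⊕ a)) refl _ _ _)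

  pow-suc-left : ∀ N h r → pow C (suc N) h r ≈ successorsSum (λ p → pow C N p r) h
  pow-suc-left N h r = begin
    pow C (1 ℕ.+ N) h r                                    ≈⟨ pow-+ 1 N h r ⟩
    sumℕ (suc (h ℕ.+ 1)) (λ p → pow C 1 h p * pow C N p r)  ≈⟨ sumℕ-cong (suc (h ℕ.+ 1)) (λ p _ → *-congʳ (pow-one h p)) ⟩
    sumℕ (suc (h ℕ.+ 1)) f                                  ≡⟨ ≡.cong (λ t → sumℕ (suc t) f) (ℕ.+-comm h 1) ⟩
    sumℕ (suc (suc h)) f                                    ≈⟨ tridiagonal-row-sum h (λ p → pow C N p r) ⟩
    successorsSum (λ p → pow C N p r) h                     ∎
    where
    f : ℕ → Carrier
    f p = C h p * pow C N p r

  motzkinFrom≈pow : ∀ N h r → motzkinFrom h N r ≈ pow C N h r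
  motzkinFrom≈pow zero    h r = motzkinFrom-zero h r
  motzkinFrom≈pow (suc N) h r = begin
    motzkinFrom h (suc N) r                          ≈⟨ motzkinFrom-suc h N r ⟩
    successorsSum (λ h′ → motzkinFrom h′ N r) h      ≈⟨ successorsSum-cong h (λ h′ → motzkinFrom≈pow N h′ r) ⟩
    successorsSum (λ h′ → pow C N h′ r) h            ≈⟨ pow-suc-left N h r ⟨
    pow C (suc N) h r                                ∎

hankel-exponent : ∀ r (i j : Fin (suc r)) → (2 ℕ.* suc r ∸ 2) ∸ toℕ i ∸ toℕ j ≡ (r ∸ toℕ i) ℕ.+ (r ∸ toℕ j)
hankel-exponent r i j = begin
  (2 ℕ.* suc r ∸ 2) ∸ toℕ i ∸ toℕ j  ≡⟨ ≡.cong (λ t → t ∸ toℕ i ∸ toℕ j) two[1+r]∸2 ⟩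
  (r ℕ.+ r) ∸ toℕ i ∸ toℕ j          ≡⟨ ≡.cong (_∸ toℕ j) (ℕ.+-∸-comm r (toℕ≤pred[n] i)) ⟩
  ((r ∸ toℕ i) ℕ.+ r) ∸ toℕ j        ≡⟨ ℕ.+-∸-assoc (r ∸ toℕ i) (toℕ≤pred[n] j) ⟩
  (r ∸ toℕ i) ℕ.+ (r ∸ toℕ j)        ∎
  where
  open ≡.≡-Reasoning
  two[1+r]∸2 : 2 ℕ.* suc r ∸ 2 ≡ r ℕ.+ r
  two[1+r]∸2 = ≡.trans (≡.cong (_∸ 1) (ℕ.+-suc r (r ℕ.+ 0))) (≡.cong (r ℕ.+_) (ℕ.+-identityʳ r))

module HankelDeterminant {c ℓ : Level} (R : CommutativeRing c ℓ) (C : Tridiag.Matrix R) (tri : Tridiag.IsTridiagonal R C) where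
  open CommutativeRing R
  open Tridiag R
  open Determinant R
  open RangeSums R
  open MatrixPowers R C tri
  open import Algebra.Properties.Semiring.Sum semiring using (sum-syntax)
  open import Relation.Binary.Reasoning.Setoid setoid

  Z-+ : ∀ a b r → b ℕ.≤ r → Z C (a ℕ.+ b) ≈ ∑[ m < suc r ] (pow C a 0 (r ∸ toℕ m) * pow C b (r ∸ toℕ m) 0)
  Z-+ a b r b≤r = begin
    pow C (a ℕ.+ b) 0 0                   ≈⟨ pow-+ a b 0 0 ⟩
    sumℕ (suc a) g                        ≈⟨ sumℕ-resize g
                                               (λ p a<p → trans (*-congʳ (pow-vanishes-above a a<p)) (zeroˡ _))
                                               (λ p r<p → trans (*-congˡ (pow-vanishes-below b (ℕ.≤-<-trans b≤r r<p))) (zeroʳ _)) ⟩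
    sumℕ (suc r) g                        ≈⟨ sumℕ-reverse r g ⟩
    ∑[ m < suc r ] g (r ∸ toℕ m)          ∎
    where
    g : ℕ → Carrier
    g p = pow C a 0 p * pow C b p 0

  hankelCofactor : ℕ → Carrier
  hankelCofactor r = product (λ (i : Fin r) → pow C (r ∸ suc (toℕ i)) 0 (r ∸ suc (toℕ i)))
                  * product (λ (k : Fin (suc r)) → pow C (r ∸ toℕ k) (r ∸ toℕ k) 0)

  numDet-hook : ∀ r m → numDet C (suc r) (hook (suc r) m) ≈ pow C (m ℕ.+ r) 0 r * hankelCofactor r
  numDet-hook r m = begin
    numDet C (suc r) (hook (suc r) m)
      ≈⟨ det-cong (suc r) {M′ = λ i j → ∑[ k < suc r ] (A i k * B k j)} entry ⟩
    det (suc r) (λ i j → ∑[ k < suc r ] (A i k * B k j))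
      ≈⟨ det-upperTriangular-* (suc r) A B A-upper ⟩
    product (λ i → A i i) * det (suc r) B
      ≈⟨ *-congˡ (det-lowerTriangular (suc r) B B-lower) ⟩
    product (λ i → A i i) * product (λ k → B k k)
      ≈⟨ *-assoc (A fzero fzero) (product (λ i → A (fsuc i) (fsuc i))) (product (λ k → B k k)) ⟩
    pow C (m ℕ.+ r) 0 r * hankelCofactor r ∎
    where
    A B : Fin (suc r) → Fin (suc r) → Carrier
    A i k = pow C (hook (suc r) m i ℕ.+ (r ∸ toℕ i)) 0 (r ∸ toℕ k)
    B k j = pow C (r ∸ toℕ j) (r ∸ toℕ k) 0
    entry : ∀ i j → Z C (hook (suc r) m i ℕ.+ ((2 ℕ.* suc r ∸ 2) ∸ toℕ i ∸ toℕ j)) ≈ ∑[ k < suc r ] (A i k * B k j)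
    entry i j = begin
      Z C (μᵢ ℕ.+ ((2 ℕ.* suc r ∸ 2) ∸ toℕ i ∸ toℕ j))  ≡⟨ ≡.cong (λ t → Z C (μᵢ ℕ.+ t)) (hankel-exponent r i j) ⟩
      Z C (μᵢ ℕ.+ ((r ∸ toℕ i) ℕ.+ (r ∸ toℕ j)))       ≡⟨ ≡.cong (Z C) (ℕ.+-assoc μᵢ (r ∸ toℕ i) (r ∸ toℕ j)) ⟨
      Z C (μᵢ ℕ.+ (r ∸ toℕ i) ℕ.+ (r ∸ toℕ j))         ≈⟨ Z-+ (μᵢ ℕ.+ (r ∸ toℕ i)) (r ∸ toℕ j) r (ℕ.m∸n≤m r (toℕ j)) ⟩
      ∑[ k < suc r ] (A i k * B k j)                   ∎
      where
      μᵢ : ℕ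
      μᵢ = hook (suc r) m i
    A-upper : ∀ {i k} → k Fin.< i → A i k ≈ 0#
    A-upper {fsuc i} k<i = pow-vanishes-above (r ∸ suc (toℕ i)) (ℕ.∸-monoʳ-< k<i (toℕ≤pred[n] (fsuc i)))
    B-lower : ∀ {k j} → k Fin.< j → B k j ≈ 0#
    B-lower {j = j} k<j = pow-vanishes-below (r ∸ toℕ j) (ℕ.∸-monoʳ-< k<j (toℕ≤pred[n] j))

  numDet-cong : ∀ n {μ ν : Fin n → ℕ} → (∀ i → μ i ≡ ν i) → numDet C n μ ≈ numDet C n ν
  numDet-cong n {μ} {ν} μ≡ν = det-cong n {λ i j → Z C (μ i ℕ.+ e i j)} {λ i j → Z C (ν i ℕ.+ e i j)}
    (λ i j → reflexive (≡.cong (λ t → Z C (t ℕ.+ e i j)) (μ≡ν i)))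
    where
    e : Fin n → Fin n → ℕ
    e i j = (2 ℕ.* n ∸ 2) ∸ toℕ i ∸ toℕ j

  numDet-zero : ∀ r → numDet C (suc r) (λ _ → 0) ≈ kr C r * hankelCofactor r
  numDet-zero r = begin
    numDet C (suc r) (λ _ → 0)            ≈⟨ numDet-cong (suc r) {λ _ → 0} {hook (suc r) 0}
                                                           (λ { fzero → ≡.refl ; (fsuc i) → ≡.refl }) ⟩
    numDet C (suc r) (hook (suc r) 0)     ≈⟨ numDet-hook r 0 ⟩
    pow C r 0 r * hankelCofactor r        ≈⟨ *-congʳ (pow-diagonal r) ⟩
    kr C r * hankelCofactor r             ∎

module Fractions {c ℓ : Level} (R : CommutativeRing c ℓ) where
  open CommutativeRing R
  open import Algebra.Solver.CommutativeMonoid *-commutativeMonoid using (solve; _⊕_; _⊜_)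
  open import Relation.Binary.Reasoning.Setoid setoid

  fraction-extend : ∀ {k k⁻¹ q d} x → k * k⁻¹ ≈ 1# → (k * q) * d ≈ 1# → x * k⁻¹ ≈ (x * q) * d
  fraction-extend {k} {k⁻¹} {q} {d} x kk⁻¹≈1 kqd≈1 = begin
    x * k⁻¹                      ≈⟨ *-identityʳ _ ⟨
    (x * k⁻¹) * 1#               ≈⟨ *-congˡ kqd≈1 ⟨
    (x * k⁻¹) * ((k * q) * d)
      ≈⟨ solve 5 (λ x k⁻¹ k q d → (x ⊕ k⁻¹) ⊕ ((k ⊕ q) ⊕ d) ⊜ ((x ⊕ q) ⊕ d) ⊕ (k ⊕ k⁻¹)) refl x k⁻¹ k q d ⟩
    ((x * q) * d) * (k * k⁻¹)    ≈⟨ *-congˡ kk⁻¹≈1 ⟩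
    ((x * q) * d) * 1#           ≈⟨ *-identityʳ _ ⟩
    (x * q) * d                  ∎

theorem4p6 : ∀ {c ℓ : Level} (R : CommutativeRing c ℓ) →
    let open CommutativeRing R
        open Tridiag R
    in (C : Matrix) → IsTridiagonal C → (N r : ℕ) → r ≤ N →
       (kinv : Carrier) → kr C r * kinv ≈ 1# →
       (dinv : Carrier) → numDet C (suc r) (λ _ → 0) * dinv ≈ 1# →
       (CMotz C N r * kinv ≈ pow C N 0 r * kinv)
       × (pow C N 0 r * kinv ≈ numDet C (suc r) (hook (suc r) (N ∸ r)) * dinv)
theorem4p6 R C tri N r r≤N kinv kr*kinv≈1 dinv det*dinv≈1 =
  *-congʳ (motzkinFrom≈pow N 0 r) , (begin
    pow C N 0 r * kinv                                   ≈⟨ fraction-extend (pow C N 0 r) kr*kinv≈1 kr*Q*dinv≈1 ⟩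
    (pow C N 0 r * hankelCofactor r) * dinv              ≡⟨ ≡.cong (λ t → (pow C t 0 r * _) * dinv) (ℕ.m∸n+n≡m r≤N) ⟨
    (pow C (N ∸ r ℕ.+ r) 0 r * hankelCofactor r) * dinv  ≈⟨ *-congʳ (numDet-hook r (N ∸ r)) ⟨
    numDet C (suc r) (hook (suc r) (N ∸ r)) * dinv       ∎)
  where
  open CommutativeRing R
  open Tridiag R
  open MatrixPowers R C tri using (motzkinFrom≈pow)
  open HankelDeterminant R C tri using (hankelCofactor; numDet-zero; numDet-hook)
  open Fractions R using (fraction-extend)
  open import Relation.Binary.Reasoning.Setoid setoid
  kr*Q*dinv≈1 : (kr C r * hankelCofactor r) * dinv ≈ 1#
  kr*Q*dinv≈1 = trans (*-congʳ (sym (numDet-zero r))) det*dinv≈1
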